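{- $\mathsf{TS}^{!\omega} \leq_{\mathrm{sW}} \mathsf{RRT}^{!(\omega+1)}_2$.
   Context: For $X \subseteq \mathbb{N}$, $[X]^{!\omega}$ is the set of finite $s \subseteq X$ with $|s| = 1+\min s$. A finite set $s \subseteq \mathbb{N}$ is exactly $(\omega+1)$-large if $s \setminus \{\min s\}$ is exactly $\omega$-large; $[X]^{!(\omega+1)}$ is the set of exactly $(\omega+1)$-large subsets of $X$. $\mathsf{TS}^{!\omega}$: instances are $f : [\mathbb{N}]^{!\omega} \to \mathbb{N}$, solutions are infinite $H \subseteq \mathbb{N}$ with $f([H]^{!\omega}) \neq \mathbb{N}$. $\mathsf{RRT}^{!(\omega+1)}_2$: instances are $2$-bounded $g : [\mathbb{N}]^{!(\omega+1)} \to \mathbb{N}$ (each value has at most $2$ preimages), solutions are infinite $H \subseteq \mathbb{N}$ such that $g$ is injective on $[H]^{!(\omega+1)}$. $\mathsf{Q} \leq_{\mathrm{sW}} \mathsf{P}$ means there are Turing functionals $\Phi, \Psi$ such that for every instance $X$ of $\mathsf{Q}$, $\Phi(X)$ is an instance of $\mathsf{P}$ and for every solution $Y$ to $\mathsf{P}$ for $\Phi(X)$, $\Psi(Y)$ is a solution to $\mathsf{Q}$ for $X$. -}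

module Defs where

open import Data.Nat using (ℕ; zero; suc; _+_; _*_; _^_; _<_; _≤_; NonZero)
open import Data.Nat.DivMod using (_/_; _%_)
open import Data.Nat.Properties using (_≟_)
open import Data.Bool using (Bool; true; false; if_then_else_)
open import Data.Fin using (Fin)
open import Data.Vec using (Vec; []; _∷_; lookup)
open import Data.List using (List; []; _∷_; length)
open import Data.List.Relation.Unary.All using (All)
open import Data.Product using (Σ; ∃; _×_; _,_)
open import Data.Sum using (_⊎_)
open import Data.Empty using (⊥)
import Data.Unit
open import Relation.Binary.PropositionalEquality using (_≡_; _≢_)
open import Relation.Nullary using (does)

-- Oracle computation: partial μ-recursive functions relative to an
-- oracle O : ℕ → ℕ, with a big-step evaluation relation.
-- A Turing functional is a code of arity 1.

data Code : ℕ → Set where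
  zer  : ∀ {n} → Code n
  succ : Code 1
  proj : ∀ {n} → Fin n → Code n
  orc  : Code 1
  comp : ∀ {m n} → Code m → Vec (Code n) m → Code n
  prec : ∀ {n} → Code n → Code (suc (suc n)) → Code (suc n)
  mu   : ∀ {n} → Code (suc n) → Code n

mutual
  data Eval (O : ℕ → ℕ) : ∀ {n} → Code n → Vec ℕ n → ℕ → Set where
    e-zer  : ∀ {n} {xs : Vec ℕ n} → Eval O zer xs 0
    e-succ : ∀ {x} → Eval O succ (x ∷ []) (suc x)
    e-proj : ∀ {n} {i : Fin n} {xs} → Eval O (proj i) xs (lookup xs i)
    e-orc  : ∀ {x} → Eval O orc (x ∷ []) (O x)
    e-comp : ∀ {m n} {f : Code m} {gs : Vec (Code n) m} {xs ys y} →
             EvalVec O gs xs ys → Eval O f ys y → Eval O (comp f gs) xs y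
    e-prec0 : ∀ {n} {f : Code n} {g} {xs y} →
              Eval O f xs y → Eval O (prec f g) (0 ∷ xs) y
    e-precS : ∀ {n} {f : Code n} {g} {k xs y z} →
              Eval O (prec f g) (k ∷ xs) y → Eval O g (k ∷ y ∷ xs) z →
              Eval O (prec f g) (suc k ∷ xs) z
    e-mu   : ∀ {n} {f : Code (suc n)} {xs k} →
             Eval O f (k ∷ xs) 0 →
             (∀ j → j < k → ∃ λ v → Eval O f (j ∷ xs) (suc v)) →
             Eval O (mu f) xs k

  data EvalVec (O : ℕ → ℕ) {n : ℕ} : ∀ {m} → Vec (Code n) m → Vec ℕ n → Vec ℕ m → Set where
    ev-[] : ∀ {xs} → EvalVec O [] xs []
    ev-∷  : ∀ {m} {g} {gs : Vec (Code n) m} {xs y ys} →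
            Eval O g xs y → EvalVec O gs xs ys → EvalVec O (g ∷ gs) xs (y ∷ ys)

Computes : (ℕ → ℕ) → Code 1 → (ℕ → ℕ) → Set
Computes O Φ F = ∀ n → Eval O Φ (n ∷ []) (F n)

χ : (ℕ → Bool) → ℕ → ℕ
χ X n = if X n then 1 else 0

Infinite : (ℕ → Bool) → Set
Infinite X = ∀ n → ∃ λ m → n ≤ m × X m ≡ true

-- The finite set with canonical code c is { i | bit i of c is 1 },
-- i.e. c = Σ_{i ∈ s} 2^i.
bit : ℕ → ℕ → Bool
bit c zero = does (c % 2 ≟ 1)
bit c (suc i) = bit (c / 2) i

elemsFrom : ℕ → ℕ → ℕ → List ℕ
elemsFrom c j zero = []
elemsFrom c j (suc k) = if bit c j then j ∷ rest else rest
  where rest = elemsFrom c (suc j) k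

-- all elements of the finite set coded by c, increasing
-- (every i with bit c i set satisfies 2^i ≤ c, hence i < c)
elems : ℕ → List ℕ
elems c = elemsFrom c 0 c

SubsetOf : ℕ → (ℕ → Bool) → Set
SubsetOf c X = All (λ i → X i ≡ true) (elems c)

-- exactly ω-large, for an increasing list: |s| = 1 + min s
ExactlyωLarge : List ℕ → Set
ExactlyωLarge [] = ⊥
ExactlyωLarge (m ∷ rest) = length rest ≡ m

Exactlyω+1Large : List ℕ → Set
Exactlyω+1Large [] = ⊥
Exactlyω+1Large (m ∷ rest) = ExactlyωLarge rest

In[_]!ω : (ℕ → Bool) → ℕ → Set
In[ X ]!ω c = ExactlyωLarge (elems c) × SubsetOf c X

In[_]!ω+1 : (ℕ → Bool) → ℕ → Set
In[ X ]!ω+1 c = Exactlyω+1Large (elems c) × SubsetOf c X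

ℕset : ℕ → Bool
ℕset _ = true

-- An instance is named by a function ℕ → ℕ (a function on
-- finite sets is named by its values at canonical codes; values at
-- codes outside the domain are irrelevant); solutions are sets.

record Problem : Set₁ where
  field
    Instance : (ℕ → ℕ) → Set
    Solution : (ℕ → ℕ) → (ℕ → Bool) → Set

open Problem public

_≤sW_ : Problem → Problem → Set
Q ≤sW P = Σ (Code 1) λ Φ → Σ (Code 1) λ Ψ →
  ∀ X → Instance Q X →
    Σ (ℕ → ℕ) λ PX → Computes X Φ PX × Instance P PX ×
      (∀ Y → Solution P PX Y →
        Σ (ℕ → Bool) λ H → Computes (χ Y) Ψ (χ H) × Solution Q X H)

TS!ω : Problem
Instance TS!ω f = Data.Unit.⊤
Solution TS!ω f H = Infinite H × (∃ λ k → ∀ c → In[ H ]!ω c → f c ≢ k)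

TwoBounded!ω+1 : (ℕ → ℕ) → Set
TwoBounded!ω+1 g = ∀ c₁ c₂ c₃ → In[ ℕset ]!ω+1 c₁ → In[ ℕset ]!ω+1 c₂ → In[ ℕset ]!ω+1 c₃ →
  g c₁ ≡ g c₂ → g c₂ ≡ g c₃ → c₁ ≡ c₂ ⊎ c₂ ≡ c₃ ⊎ c₁ ≡ c₃

RRT!ω+1₂ : Problem
Instance RRT!ω+1₂ g = TwoBounded!ω+1 g
Solution RRT!ω+1₂ g H = Infinite H ×
  (∀ c₁ c₂ → In[ H ]!ω+1 c₁ → In[ H ]!ω+1 c₂ → g c₁ ≡ g c₂ → c₁ ≡ c₂)

{-# OPTIONS --safe #-}
-- For s exactly (ω+1)-large let m = min s and t = s ∖ {m}, and colour s by the pair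
-- (∣2m − f(t)∣ , t), coded as 2^∣2m − f(t)∣ · (2t + 1). Two sets share a colour only if
-- they have the same t and their minima are equal or symmetric about f(t)/2, so at most two
-- sets share a colour. If Y is infinite and the colouring is injective on [Y]^{!(ω+1)}, let
-- a < b be the two least elements of Y and H = Y ∖ {a, b}. For s ∈ [H]^{!ω} the sets
-- {a} ∪ s and {b} ∪ s lie in [Y]^{!(ω+1)} and get the same colour when f(s) = a + b, so f
-- omits a + b on [H]^{!ω}. Both functionals are computable: min s is the lowest set bit of
-- the code of s, found by unbounded search, and H consists of the elements of Y with at
-- least two smaller elements in Y.
module Submission where

open import Data.Bool using (Bool; true; false; if_then_else_; _∧_)
open import Data.Bool.Properties using (∧-conicalˡ; ∧-conicalʳ; T-≡)
open import Data.Fin using (zero; suc)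
open import Data.List using ([]; _∷_; map)
open import Data.List.Properties using (map-id; map-∘; map-cong; ∷-injectiveˡ)
open import Data.List.Relation.Unary.All as All using (All; []; _∷_)
import Data.List.Relation.Unary.All.Properties as All
open import Data.Nat
open import Data.Nat.DivMod
  using (_/_; _%_; m*n%n≡0; m*n/n≡m; [m+kn]%n≡m%n; +-distrib-/; m/n≡1+[m∸n]/n; m/n<m; %-congˡ; /-congˡ)
open import Data.Nat.Induction using (<-rec)
open import Data.Nat.Properties
open import Data.Product using (∃; ∃₂; _×_; _,_; proj₁; proj₂)
open import Data.Sum as Sum using (_⊎_; inj₁; inj₂)
open import Data.Vec using (Vec; []; _∷_)
open import Function.Bundles using (Equivalence)
open import Relation.Binary.PropositionalEquality
open import Relation.Nullary using (contradiction)

open import Defs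

data EvenOdd : ℕ → Set where
  even : ∀ m → EvenOdd (2 * m)
  odd  : ∀ m → EvenOdd (suc (2 * m))

evenOdd : ∀ n → EvenOdd n
evenOdd zero = even 0
evenOdd (suc n) with evenOdd n
... | even m = odd m
... | odd m = subst EvenOdd (*-suc 2 m) (even (suc m))

2*m%2≡0 : ∀ m → 2 * m % 2 ≡ 0
2*m%2≡0 m = trans (%-congˡ (*-comm 2 m)) (m*n%n≡0 m 2)

[1+2*m]%2≡1 : ∀ m → suc (2 * m) % 2 ≡ 1
[1+2*m]%2≡1 m = trans (%-congˡ {o = 2} (cong suc (*-comm 2 m))) ([m+kn]%n≡m%n 1 m 2)

2*m/2≡m : ∀ m → 2 * m / 2 ≡ m
2*m/2≡m m = trans (/-congˡ (*-comm 2 m)) (m*n/n≡m m 2)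

[1+2*m]/2≡m : ∀ m → suc (2 * m) / 2 ≡ m
[1+2*m]/2≡m m = begin
  suc (2 * m) / 2      ≡⟨ +-distrib-/ 1 (2 * m) (subst (λ r → 1 + r < 2) (sym (2*m%2≡0 m)) ≤-refl) ⟩
  0 + 2 * m / 2        ≡⟨ 2*m/2≡m m ⟩
  m                    ∎
  where open ≡-Reasoning

[1+n]%2≡1∸n%2 : ∀ n → suc n % 2 ≡ 1 ∸ n % 2
[1+n]%2≡1∸n%2 n with evenOdd n
... | even m rewrite [1+2*m]%2≡1 m | 2*m%2≡0 m = refl
... | odd m rewrite [1+2*m]%2≡1 m | 2*m%2≡0 m = refl

[1+n]/2≡n/2+n%2 : ∀ n → suc n / 2 ≡ n / 2 + n % 2
[1+n]/2≡n/2+n%2 n with evenOdd n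
... | even m rewrite [1+2*m]/2≡m m | 2*m/2≡m m | 2*m%2≡0 m = sym (+-identityʳ m)
... | odd m rewrite m/n≡1+[m∸n]/n {suc (suc (2 * m))} {2} (s≤s (s≤s z≤n))
                  | 2*m/2≡m m | [1+2*m]/2≡m m | [1+2*m]%2≡1 m = +-comm 1 m

elemsFrom-suc : ∀ c j k → elemsFrom c (suc j) k ≡ map suc (elemsFrom (c / 2) j k)
elemsFrom-suc c j zero = refl
elemsFrom-suc c j (suc k) with bit (c / 2) j
... | true = cong (suc j ∷_) (elemsFrom-suc c (suc j) k)
... | false = elemsFrom-suc c (suc j) k

bit-empty : ∀ j → bit 0 j ≡ false
bit-empty zero = refl
bit-empty (suc j) = bit-empty j

elemsFrom-empty : ∀ j k → elemsFrom 0 j k ≡ []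
elemsFrom-empty j zero = refl
elemsFrom-empty j (suc k) rewrite bit-empty j = elemsFrom-empty (suc j) k

[1+c]/2≤c : ∀ c → suc c / 2 ≤ c
[1+c]/2≤c c = ≤-pred (m/n<m (suc c) 2 (s≤s (s≤s z≤n)))

elemsFrom-stable : ∀ c k k′ → c ≤ k → c ≤ k′ → elemsFrom c 0 k ≡ elemsFrom c 0 k′
elemsFrom-stable zero k k′ _ _ = trans (elemsFrom-empty 0 k) (sym (elemsFrom-empty 0 k′))
elemsFrom-stable (suc c) (suc k) (suc k′) (s≤s c≤k) (s≤s c≤k′)
  rewrite elemsFrom-suc (suc c) 0 k | elemsFrom-suc (suc c) 0 k′
        | elemsFrom-stable (suc c / 2) k k′ (≤-trans ([1+c]/2≤c c) c≤k) (≤-trans ([1+c]/2≤c c) c≤k′) = refl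

elems-unfold : ∀ c → elems c ≡ (if bit c 0 then 0 ∷ map suc (elems (c / 2)) else map suc (elems (c / 2)))
elems-unfold zero = refl
elems-unfold (suc c) rewrite elemsFrom-suc (suc c) 0 c
  | elemsFrom-stable (suc c / 2) c (suc c / 2) ([1+c]/2≤c c) ≤-refl = refl

elems-2* : ∀ m → elems (2 * m) ≡ map suc (elems m)
elems-2* m rewrite elems-unfold (2 * m) | 2*m%2≡0 m | 2*m/2≡m m = refl

elems-1+2* : ∀ m → elems (suc (2 * m)) ≡ 0 ∷ map suc (elems m)
elems-1+2* m rewrite elems-unfold (suc (2 * m)) | [1+2*m]%2≡1 m | [1+2*m]/2≡m m = refl

-- Codes of the form 2^k (2q + 1) and the least element

2^[1+k]*m≡2^k*[2*m] : ∀ k m → 2 ^ suc k * m ≡ 2 ^ k * (2 * m)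
2^[1+k]*m≡2^k*[2*m] k m = trans (cong (_* m) (*-comm 2 (2 ^ k))) (*-assoc (2 ^ k) 2 m)

2^k*odd≡2^k+2^[1+k]*q : ∀ k q → 2 ^ k * suc (2 * q) ≡ 2 ^ k + 2 ^ suc k * q
2^k*odd≡2^k+2^[1+k]*q k q = trans (*-suc (2 ^ k) (2 * q)) (cong (2 ^ k +_) (sym (2^[1+k]*m≡2^k*[2*m] k q)))

elems-2^k* : ∀ k m → elems (2 ^ k * m) ≡ map (k +_) (elems m)
elems-2^k* zero m rewrite *-identityˡ m = sym (map-id (elems m))
elems-2^k* (suc k) m rewrite *-assoc 2 (2 ^ k) m | elems-2* (2 ^ k * m) | elems-2^k* k m =
  sym (map-∘ (elems m))

elems-2^k*odd : ∀ k q → elems (2 ^ k * suc (2 * q)) ≡ k ∷ elems (2 ^ suc k * q)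
elems-2^k*odd k q rewrite elems-2^k* k (suc (2 * q)) | elems-1+2* q | elems-2^k* (suc k) q =
  cong₂ _∷_ (+-identityʳ k) (trans (sym (map-∘ (elems q))) (map-cong (+-suc k) (elems q)))

all>⇒2^[1+a]∣ : ∀ a c → All (a <_) (elems c) → ∃ λ q → c ≡ 2 ^ suc a * q
all>⇒2^[1+a]∣ a c a<c with evenOdd c
... | odd m with subst (All (a <_)) (elems-1+2* m) a<c
...   | () ∷ _
all>⇒2^[1+a]∣ zero c a<c | even m = m , refl
all>⇒2^[1+a]∣ (suc a) c a<c | even m
  with all>⇒2^[1+a]∣ a m (All.map ≤-pred (All.map⁻ (subst (All (suc a <_)) (elems-2* m) a<c)))
... | q , refl = q , sym (*-assoc 2 (2 ^ suc a) q)

2^k*odd-injective : ∀ k k′ q q′ → 2 ^ k * suc (2 * q) ≡ 2 ^ k′ * suc (2 * q′) → k ≡ k′ × q ≡ q′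
2^k*odd-injective zero zero q q′ e =
  refl , *-cancelˡ-≡ q q′ 2 (suc-injective (trans (sym (*-identityˡ _)) (trans e (*-identityˡ _))))
2^k*odd-injective zero (suc k′) q q′ e =
  contradiction (trans (sym (*-assoc 2 (2 ^ k′) _)) (trans (sym e) (*-identityˡ (suc (2 * q)))))
                (even≢odd (2 ^ k′ * suc (2 * q′)) q)
2^k*odd-injective (suc k) zero q q′ e =
  contradiction (trans (sym (*-assoc 2 (2 ^ k) _)) (trans e (*-identityˡ (suc (2 * q′)))))
                (even≢odd (2 ^ k * suc (2 * q)) q′)
2^k*odd-injective (suc k) (suc k′) q q′ e
  with 2^k*odd-injective k k′ q q′
         (*-cancelˡ-≡ (2 ^ k * suc (2 * q)) (2 ^ k′ * suc (2 * q′)) 2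
           (trans (sym (*-assoc 2 (2 ^ k) _)) (trans e (*-assoc 2 (2 ^ k′) _))))
... | refl , q≡q′ = refl , q≡q′

2^k*odd-exists : ∀ c → 0 < c → ∃₂ λ k q → c ≡ 2 ^ k * suc (2 * q)
2^k*odd-exists = <-rec _ step
  where
  step : ∀ c → (∀ {c′} → c′ < c → 0 < c′ → ∃₂ λ k q → c′ ≡ 2 ^ k * suc (2 * q)) →
         0 < c → ∃₂ λ k q → c ≡ 2 ^ k * suc (2 * q)
  step c rec 0<c with evenOdd c
  ... | odd q = 0 , q , sym (*-identityˡ _)
  ... | even (suc m) with rec (m<m+n (suc m) z<s) z<s
  ...   | k , q , e = suc k , q , trans (cong (2 *_) e) (sym (*-assoc 2 (2 ^ k) (suc (2 * q))))

2^k*odd>0 : ∀ k q → 0 < 2 ^ k * suc (2 * q)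
2^k*odd>0 k q = >-nonZero⁻¹ _ {{m*n≢0 (2 ^ k) _ {{m^n≢0 2 k}}}}

minElem : ℕ → ℕ
minElem zero = 0
minElem c@(suc _) = proj₁ (2^k*odd-exists c z<s)

dropMin : ℕ → ℕ
dropMin c = c ∸ 2 ^ minElem c

minElem-spec : ∀ c → 0 < c → ∃ λ q → c ≡ 2 ^ minElem c * suc (2 * q)
minElem-spec (suc c) _ = proj₂ (2^k*odd-exists (suc c) z<s)

minElem-2^k*odd : ∀ k q → minElem (2 ^ k * suc (2 * q)) ≡ k
minElem-2^k*odd k q with minElem-spec _ (2^k*odd>0 k q)
... | q′ , e = proj₁ (2^k*odd-injective _ k q′ q (sym e))

dropMin-2^k*odd : ∀ k q → dropMin (2 ^ k * suc (2 * q)) ≡ 2 ^ suc k * q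
dropMin-2^k*odd k q rewrite minElem-2^k*odd k q | 2^k*odd≡2^k+2^[1+k]*q k q = m+n∸m≡n (2 ^ k) (2 ^ suc k * q)

2^minElem+dropMin : ∀ c → 0 < c → 2 ^ minElem c + dropMin c ≡ c
2^minElem+dropMin c 0<c with minElem-spec c 0<c
... | q , e = m+[n∸m]≡n (subst (2 ^ minElem c ≤_) (sym (trans e (2^k*odd≡2^k+2^[1+k]*q (minElem c) q)))
                                (m≤m+n (2 ^ minElem c) (2 ^ suc (minElem c) * q)))

adjoin-below : ∀ a c → All (a <_) (elems c) →
               ∃ λ c′ → elems c′ ≡ a ∷ elems c × minElem c′ ≡ a × dropMin c′ ≡ c
adjoin-below a c a<c with all>⇒2^[1+a]∣ a c a<c
... | q , refl = 2 ^ a * suc (2 * q) , elems-2^k*odd a q , minElem-2^k*odd a q , dropMin-2^k*odd a q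

halve^ : ℕ → ℕ → ℕ
halve^ zero c = c
halve^ (suc i) c = halve^ i c / 2

halve^-2^i* : ∀ i m → halve^ i (2 ^ i * m) ≡ m
halve^-2^i* zero m = *-identityˡ m
halve^-2^i* (suc i) m rewrite 2^[1+k]*m≡2^k*[2*m] i m | halve^-2^i* i (2 * m) = 2*m/2≡m m

halve^-2^k*-even : ∀ j k m → j < k → halve^ j (2 ^ k * m) % 2 ≡ 0
halve^-2^k*-even j k m j<k with m≤n⇒∃[o]m+o≡n j<k
... | o , refl = begin
  halve^ j (2 ^ (suc j + o) * m) % 2     ≡⟨ cong (λ e → halve^ j (2 ^ e * m) % 2) (sym (+-suc j o)) ⟩
  halve^ j (2 ^ (j + suc o) * m) % 2     ≡⟨ cong (λ x → halve^ j (x * m) % 2) (^-distribˡ-+-* 2 j (suc o)) ⟩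
  halve^ j (2 ^ j * 2 ^ suc o * m) % 2   ≡⟨ cong (λ x → halve^ j x % 2) (*-assoc (2 ^ j) (2 ^ suc o) m) ⟩
  halve^ j (2 ^ j * (2 ^ suc o * m)) % 2 ≡⟨ cong (_% 2) (halve^-2^i* j (2 ^ suc o * m)) ⟩
  2 ^ suc o * m % 2                      ≡⟨ cong (_% 2) (*-assoc 2 (2 ^ o) m) ⟩
  2 * (2 ^ o * m) % 2                    ≡⟨ 2*m%2≡0 (2 ^ o * m) ⟩
  0                                      ∎
  where open ≡-Reasoning

halve^-minElem-odd : ∀ c → 0 < c → halve^ (minElem c) c % 2 ≡ 1
halve^-minElem-odd c 0<c with minElem-spec c 0<c
... | q , e = trans (cong (λ x → halve^ (minElem c) x % 2) e)
                    (trans (cong (_% 2) (halve^-2^i* (minElem c) _)) ([1+2*m]%2≡1 q))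

halve^-below-minElem-even : ∀ c j → j < minElem c → halve^ j c % 2 ≡ 0
halve^-below-minElem-even zero j ()
halve^-below-minElem-even (suc c) j j<k with minElem-spec (suc c) z<s
... | q , e = trans (cong (λ x → halve^ j x % 2) e) (halve^-2^k*-even j (minElem (suc c)) _ j<k)

-- The factor c stops the search at 0 when c = 0, which keeps minElemC total.
lowBitTest : ℕ → ℕ → ℕ
lowBitTest i c = c * (1 ∸ halve^ i c % 2)

lowBitTest-minElem : ∀ c → lowBitTest (minElem c) c ≡ 0
lowBitTest-minElem zero = refl
lowBitTest-minElem c@(suc _) rewrite halve^-minElem-odd c z<s = *-zeroʳ c

lowBitTest-below-minElem : ∀ c j → j < minElem c → lowBitTest j c ≢ 0
lowBitTest-below-minElem zero j ()
lowBitTest-below-minElem c@(suc _) j j<k rewrite halve^-below-minElem-even c j j<k = λ ()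

∣m-n∣≡m∸n+n∸m : ∀ m n → ∣ m - n ∣ ≡ (m ∸ n) + (n ∸ m)
∣m-n∣≡m∸n+n∸m zero n = cong (_+ n) (sym (0∸n≡0 n))
∣m-n∣≡m∸n+n∸m (suc m) zero = sym (+-identityʳ (suc m))
∣m-n∣≡m∸n+n∸m (suc m) (suc n) = ∣m-n∣≡m∸n+n∸m m n

m≡o+∣m-o∣⊎m+∣m-o∣≡o : ∀ m o → m ≡ o + ∣ m - o ∣ ⊎ m + ∣ m - o ∣ ≡ o
m≡o+∣m-o∣⊎m+∣m-o∣≡o zero o = inj₂ refl
m≡o+∣m-o∣⊎m+∣m-o∣≡o (suc m) zero = inj₁ refl
m≡o+∣m-o∣⊎m+∣m-o∣≡o (suc m) (suc o) = Sum.map (cong suc) (cong suc) (m≡o+∣m-o∣⊎m+∣m-o∣≡o m o)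

m≡o+d⇒n+d≡o⇒m+n≡o+o : ∀ {m n o d} → m ≡ o + d → n + d ≡ o → m + n ≡ o + o
m≡o+d⇒n+d≡o⇒m+n≡o+o {m} {n} {o} {d} m≡o+d n+d≡o = begin
  m + n        ≡⟨ cong (_+ n) m≡o+d ⟩
  o + d + n    ≡⟨ +-assoc o d n ⟩
  o + (d + n)  ≡⟨ cong (o +_) (+-comm d n) ⟩
  o + (n + d)  ≡⟨ cong (o +_) n+d≡o ⟩
  o + o        ∎
  where open ≡-Reasoning

∣m-o∣≡∣n-o∣⇒m≡n⊎m+n≡o+o : ∀ m n o → ∣ m - o ∣ ≡ ∣ n - o ∣ → m ≡ n ⊎ m + n ≡ o + o
∣m-o∣≡∣n-o∣⇒m≡n⊎m+n≡o+o m n o e with m≡o+∣m-o∣⊎m+∣m-o∣≡o m o | m≡o+∣m-o∣⊎m+∣m-o∣≡o n o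
... | inj₁ m≡ | inj₁ n≡ = inj₁ (trans m≡ (trans (cong (o +_) e) (sym n≡)))
... | inj₂ m+ | inj₂ n+ = inj₁ (+-cancelʳ-≡ ∣ m - o ∣ m n (trans m+ (trans (sym n+) (cong (n +_) (sym e)))))
... | inj₁ m≡ | inj₂ n+ = inj₂ (m≡o+d⇒n+d≡o⇒m+n≡o+o (trans m≡ (cong (o +_) e)) n+)
... | inj₂ m+ | inj₁ n≡ = inj₂ (trans (+-comm m n) (m≡o+d⇒n+d≡o⇒m+n≡o+o (trans n≡ (cong (o +_) (sym e))) m+))

∣m-o∣-2-bounded : ∀ o m₁ m₂ m₃ → ∣ m₁ - o ∣ ≡ ∣ m₂ - o ∣ → ∣ m₂ - o ∣ ≡ ∣ m₃ - o ∣ →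
                  m₁ ≡ m₂ ⊎ m₂ ≡ m₃ ⊎ m₁ ≡ m₃
∣m-o∣-2-bounded o m₁ m₂ m₃ e₁₂ e₂₃
  with ∣m-o∣≡∣n-o∣⇒m≡n⊎m+n≡o+o m₁ m₂ o e₁₂ | ∣m-o∣≡∣n-o∣⇒m≡n⊎m+n≡o+o m₂ m₃ o e₂₃
... | inj₁ m₁≡m₂ | _ = inj₁ m₁≡m₂
... | inj₂ _ | inj₁ m₂≡m₃ = inj₂ (inj₁ m₂≡m₃)
... | inj₂ s₁₂ | inj₂ s₂₃ = inj₂ (inj₂ (+-cancelˡ-≡ m₂ m₁ m₃ (trans (+-comm m₂ m₁) (trans s₁₂ (sym s₂₃)))))

∣2a-[a+b]∣≡∣2b-[a+b]∣ : ∀ a b → ∣ 2 * a - (a + b) ∣ ≡ ∣ 2 * b - (a + b) ∣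
∣2a-[a+b]∣≡∣2b-[a+b]∣ a b = begin
  ∣ 2 * a - (a + b) ∣   ≡⟨ cong (λ x → ∣ a + x - a + b ∣) (+-identityʳ a) ⟩
  ∣ a + a - a + b ∣     ≡⟨ ∣m+n-m+o∣≡∣n-o∣ a a b ⟩
  ∣ a - b ∣             ≡⟨ ∣-∣-comm a b ⟩
  ∣ b - a ∣             ≡⟨ ∣m+n-m+o∣≡∣n-o∣ b b a ⟨
  ∣ b + b - b + a ∣     ≡⟨ cong₂ (λ x y → ∣ b + x - y ∣) (+-identityʳ b) (+-comm a b) ⟨
  ∣ 2 * b - (a + b) ∣   ∎
  where open ≡-Reasoning

-- The RRT instance built from f

rainbowInstance : (ℕ → ℕ) → ℕ → ℕ
rainbowInstance f c = 2 ^ ∣ 2 * minElem c - f (dropMin c) ∣ * suc (2 * dropMin c)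

rainbowInstance-≡ : ∀ f c c′ → rainbowInstance f c ≡ rainbowInstance f c′ →
                    dropMin c ≡ dropMin c′ × ∣ 2 * minElem c - f (dropMin c) ∣ ≡ ∣ 2 * minElem c′ - f (dropMin c) ∣
rainbowInstance-≡ f c c′ e with 2^k*odd-injective _ _ (dropMin c) (dropMin c′) e
... | y≡y′ , r≡r′ = r≡r′ , trans y≡y′ (cong (λ r → ∣ 2 * minElem c′ - f r ∣) (sym r≡r′))

minElem-dropMin-injective : ∀ c c′ → 0 < c → 0 < c′ → minElem c ≡ minElem c′ → dropMin c ≡ dropMin c′ → c ≡ c′
minElem-dropMin-injective c c′ 0<c 0<c′ m≡m′ r≡r′ =
  trans (sym (2^minElem+dropMin c 0<c)) (trans (cong₂ (λ k r → 2 ^ k + r) m≡m′ r≡r′) (2^minElem+dropMin c′ 0<c′))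

In!ω+1⇒>0 : ∀ {X} c → In[ X ]!ω+1 c → 0 < c
In!ω+1⇒>0 zero (() , _)
In!ω+1⇒>0 (suc c) _ = z<s

rainbowInstance-2-bounded : ∀ f → TwoBounded!ω+1 (rainbowInstance f)
rainbowInstance-2-bounded f c₁ c₂ c₃ s₁ s₂ s₃ e₁₂ e₂₃
  with rainbowInstance-≡ f c₁ c₂ e₁₂ | rainbowInstance-≡ f c₂ c₃ e₂₃
... | r₁₂ , d₁₂ | r₂₃ , d₂₃ =
  Sum.map (same s₁ s₂ r₁₂) (Sum.map (same s₂ s₃ r₂₃) (same s₁ s₃ (trans r₁₂ r₂₃)))
    (∣m-o∣-2-bounded (f (dropMin c₁)) _ _ _ d₁₂
      (trans (cong (dist c₂) r₁₂) (trans d₂₃ (cong (dist c₃) (sym r₁₂)))))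
  where
  dist : ℕ → ℕ → ℕ
  dist c r = ∣ 2 * minElem c - f r ∣
  same : ∀ {c c′} → In[ ℕset ]!ω+1 c → In[ ℕset ]!ω+1 c′ →
         dropMin c ≡ dropMin c′ → 2 * minElem c ≡ 2 * minElem c′ → c ≡ c′
  same {c} {c′} s s′ r≡r′ 2m≡2m′ =
    minElem-dropMin-injective c c′ (In!ω+1⇒>0 c s) (In!ω+1⇒>0 c′ s′) (*-cancelˡ-≡ _ _ 2 2m≡2m′) r≡r′

-- Removing the two least elements of a set

count : (ℕ → Bool) → ℕ → ℕ
count Y zero = 0
count Y (suc n) = count Y n + χ Y n

dropTwoMin : (ℕ → Bool) → ℕ → Bool
dropTwoMin Y n = Y n ∧ (2 ≤ᵇ count Y n)

module _ {Y : ℕ → Bool} where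

  count-mono : ∀ {m n} → m ≤ n → count Y m ≤ count Y n
  count-mono m≤n = go (≤⇒≤′ m≤n)
    where
    go : ∀ {m n} → m ≤′ n → count Y m ≤ count Y n
    go ≤′-refl = ≤-refl
    go (≤′-step m≤′n) = ≤-trans (go m≤′n) (m≤m+n _ _)

  count-<⇒< : ∀ {m n} → count Y m < count Y n → m < n
  count-<⇒< lt = ≰⇒> (λ n≤m → <⇒≱ lt (count-mono n≤m))

  count-suc-member : ∀ m → Y m ≡ true → count Y (suc m) ≡ suc (count Y m)
  count-suc-member m Ym rewrite Ym = +-comm (count Y m) 1

  count-unbounded : Infinite Y → ∀ j → ∃ λ N → j < count Y N
  count-unbounded Y-inf zero with Y-inf 0
  ... | m , _ , Ym = suc m , subst (0 <_) (sym (count-suc-member m Ym)) z<s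
  count-unbounded Y-inf (suc j) with count-unbounded Y-inf j
  ... | N , j<N with Y-inf N
  ...   | m , N≤m , Ym =
    suc m , subst (suc j <_) (sym (count-suc-member m Ym)) (s≤s (<-≤-trans j<N (count-mono N≤m)))

  count-hits : ∀ N j → j < count Y N → ∃ λ m → Y m ≡ true × count Y m ≡ j
  count-hits zero j ()
  count-hits (suc N) j j<N with Y N in YN
  ... | false = count-hits N j (subst (j <_) (+-identityʳ (count Y N)) j<N)
  ... | true with m≤n⇒m<n∨m≡n (≤-pred (subst (j <_) (+-comm (count Y N) 1) j<N))
  ...   | inj₁ j<N′ = count-hits N j j<N′
  ...   | inj₂ refl = N , YN , refl

  nth-element : Infinite Y → ∀ j → ∃ λ m → Y m ≡ true × count Y m ≡ j
  nth-element Y-inf j with count-unbounded Y-inf j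
  ... | N , j<N = count-hits N j j<N

  dropTwoMin-⊆ : ∀ {n} → dropTwoMin Y n ≡ true → Y n ≡ true
  dropTwoMin-⊆ {n} e = ∧-conicalˡ (Y n) _ e

  dropTwoMin-above : ∀ {m n} → count Y m < 2 → dropTwoMin Y n ≡ true → m < n
  dropTwoMin-above {m} {n} m<2 e =
    count-<⇒< (<-≤-trans m<2 (≤ᵇ⇒≤ 2 _ (Equivalence.from T-≡ (∧-conicalʳ (Y n) _ e))))

  dropTwoMin-infinite : Infinite Y → Infinite (dropTwoMin Y)
  dropTwoMin-infinite Y-inf n with count-unbounded Y-inf 1
  ... | N , 1<N with Y-inf (N + n)
  ...   | m , N+n≤m , Ym =
    m , ≤-trans (m≤n+m n N) N+n≤m ,
    cong₂ _∧_ Ym (Equivalence.to T-≡ (≤⇒≤ᵇ (≤-trans 1<N (count-mono (≤-trans (m≤m+n N n) N+n≤m)))))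

  χ-dropTwoMin : ∀ n → χ (dropTwoMin Y) n ≡ χ Y n * (1 ∸ (2 ∸ count Y n))
  χ-dropTwoMin n with Y n
  ... | false = refl
  ... | true with count Y n
  ...   | zero = refl
  ...   | suc zero = refl
  ...   | suc (suc k) rewrite 0∸n≡0 k = refl

dropTwoMin-adjoin : ∀ f {Y} c → In[ dropTwoMin Y ]!ω c → ∀ x → Y x ≡ true → count Y x < 2 →
                    ∃ λ c′ → In[ Y ]!ω+1 c′ × elems c′ ≡ x ∷ elems c ×
                             rainbowInstance f c′ ≡ 2 ^ ∣ 2 * x - f c ∣ * suc (2 * c)
dropTwoMin-adjoin f {Y} c (large , c⊆) x Yx x<2 with adjoin-below x c (All.map (dropTwoMin-above x<2) c⊆)
... | c′ , elems≡ , min≡x , drop≡c =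
  c′ , (subst Exactlyω+1Large (sym elems≡) large ,
        subst (All (λ i → Y i ≡ true)) (sym elems≡) (Yx ∷ All.map (dropTwoMin-⊆ {Y}) c⊆)) ,
  elems≡ , cong₂ (λ m r → 2 ^ ∣ 2 * m - f r ∣ * suc (2 * r)) min≡x drop≡c

dropTwoMin-avoids : ∀ f {Y} → Infinite Y →
                    (∀ c₁ c₂ → In[ Y ]!ω+1 c₁ → In[ Y ]!ω+1 c₂ →
                       rainbowInstance f c₁ ≡ rainbowInstance f c₂ → c₁ ≡ c₂) →
                    ∃ λ k → ∀ c → In[ dropTwoMin Y ]!ω c → f c ≢ k
dropTwoMin-avoids f {Y} Y-infinite Y-rainbow with nth-element Y-infinite 0 | nth-element Y-infinite 1
... | a , Ya , ca | b , Yb , cb = a + b , avoids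
  where
  avoids : ∀ c → In[ dropTwoMin Y ]!ω c → f c ≢ a + b
  avoids c c∈ fc≡a+b
    with dropTwoMin-adjoin f c c∈ a Ya (subst (_< 2) (sym ca) z<s)
       | dropTwoMin-adjoin f c c∈ b Yb (subst (_< 2) (sym cb) (s≤s z<s))
  ... | cₐ , cₐ∈ , elemsₐ , gₐ | c_b , c_b∈ , elems_b , g_b =
    0≢1+n (trans (sym ca) (trans (cong (count Y) a≡b) cb))
    where
    same-value : rainbowInstance f cₐ ≡ rainbowInstance f c_b
    same-value = begin
      rainbowInstance f cₐ                  ≡⟨ gₐ ⟩
      2 ^ ∣ 2 * a - f c ∣ * suc (2 * c)       ≡⟨ cong (λ v → 2 ^ ∣ 2 * a - v ∣ * suc (2 * c)) fc≡a+b ⟩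
      2 ^ ∣ 2 * a - (a + b) ∣ * suc (2 * c)   ≡⟨ cong (λ y → 2 ^ y * suc (2 * c)) (∣2a-[a+b]∣≡∣2b-[a+b]∣ a b) ⟩
      2 ^ ∣ 2 * b - (a + b) ∣ * suc (2 * c)   ≡⟨ cong (λ v → 2 ^ ∣ 2 * b - v ∣ * suc (2 * c)) fc≡a+b ⟨
      2 ^ ∣ 2 * b - f c ∣ * suc (2 * c)       ≡⟨ g_b ⟨
      rainbowInstance f c_b                 ∎
      where open ≡-Reasoning
    a≡b : a ≡ b
    a≡b = ∷-injectiveˡ (trans (sym elemsₐ) (trans (cong elems (Y-rainbow cₐ c_b cₐ∈ c_b∈ same-value)) elems_b))

private variable
  n : ℕ
  xs : Vec ℕ n
  a b : Code n
  u v z : ℕ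

#0 : Code (suc n)
#0 = proj zero

#1 : Code (suc (suc n))
#1 = proj (suc zero)

#2 : Code (suc (suc (suc n)))
#2 = proj (suc (suc zero))

one two : Code n
one = comp succ (zer ∷ [])
two = comp succ (one ∷ [])

infixr 9 _·_
infixl 7 _*ᶜ_
infixl 6 _+ᶜ_ _∸ᶜ_

_·_ : Code 1 → Code n → Code n
g · a = comp g (a ∷ [])

predC : Code 1
predC = prec zer #0

addC : Code 2
addC = prec #0 (succ · #1)

_+ᶜ_ : Code n → Code n → Code n
a +ᶜ b = comp addC (a ∷ b ∷ [])

-- Primitive recursion runs on the first argument, so monusC computes (k , x) ↦ x ∸ k.
monusC : Code 2
monusC = prec #0 (predC · #1)

_∸ᶜ_ : Code n → Code n → Code n
a ∸ᶜ b = comp monusC (b ∷ a ∷ [])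

mulC : Code 2
mulC = prec zer (#2 +ᶜ #1)

_*ᶜ_ : Code n → Code n → Code n
a *ᶜ b = comp mulC (a ∷ b ∷ [])

∣_-ᶜ_∣ : Code n → Code n → Code n
∣ a -ᶜ b ∣ = (a ∸ᶜ b) +ᶜ (b ∸ᶜ a)

mod2C : Code 1
mod2C = prec zer (one ∸ᶜ #1)

halfC : Code 1
halfC = prec zer (#1 +ᶜ mod2C · #0)

pow2C : Code 1
pow2C = prec one (two *ᶜ #1)

halve^C : Code 2
halve^C = prec #0 (halfC · #1)

lowBitTestC : Code 2
lowBitTestC = #1 *ᶜ (one ∸ᶜ mod2C · halve^C)

minElemC : Code 1
minElemC = mu lowBitTestC

dropMinC : Code 1
dropMinC = #0 ∸ᶜ pow2C · minElemC

Φ : Code 1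
Φ = pow2C · ∣ two *ᶜ minElemC -ᶜ orc · dropMinC ∣ *ᶜ succ · (two *ᶜ dropMinC)

countC : Code 1
countC = prec zer (#1 +ᶜ orc · #0)

Ψ : Code 1
Ψ = orc · #0 *ᶜ (one ∸ᶜ (two ∸ᶜ countC · #0))

module _ {O : ℕ → ℕ} where

  ev-one : Eval O one xs 1
  ev-one = e-comp (ev-∷ e-zer ev-[]) e-succ

  ev-two : Eval O two xs 2
  ev-two = e-comp (ev-∷ ev-one ev-[]) e-succ

  ev-· : ∀ {g : Code 1} → Eval O a xs u → Eval O g (u ∷ []) v → Eval O (g · a) xs v
  ev-· ea eg = e-comp (ev-∷ ea ev-[]) eg

  ev-comp₂ : ∀ {g : Code 2} → Eval O a xs u → Eval O b xs v → Eval O g (u ∷ v ∷ []) z →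
             Eval O (comp g (a ∷ b ∷ [])) xs z
  ev-comp₂ ea eb eg = e-comp (ev-∷ ea (ev-∷ eb ev-[])) eg

  addC-correct : ∀ m k → Eval O addC (m ∷ k ∷ []) (m + k)
  addC-correct zero k = e-prec0 e-proj
  addC-correct (suc m) k = e-precS (addC-correct m k) (ev-· e-proj e-succ)

  ev-+ᶜ : Eval O a xs u → Eval O b xs v → Eval O (a +ᶜ b) xs (u + v)
  ev-+ᶜ ea eb = ev-comp₂ ea eb (addC-correct _ _)

  predC-correct : ∀ m → Eval O predC (m ∷ []) (pred m)
  predC-correct zero = e-prec0 e-zer
  predC-correct (suc m) = e-precS (predC-correct m) e-proj

  monusC-correct : ∀ k x → Eval O monusC (k ∷ x ∷ []) (x ∸ k)
  monusC-correct zero x = e-prec0 e-proj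
  monusC-correct (suc k) x = subst (Eval O monusC _) (pred[m∸n]≡m∸[1+n] x k)
    (e-precS (monusC-correct k x) (ev-· e-proj (predC-correct (x ∸ k))))

  ev-∸ᶜ : Eval O a xs u → Eval O b xs v → Eval O (a ∸ᶜ b) xs (u ∸ v)
  ev-∸ᶜ ea eb = ev-comp₂ eb ea (monusC-correct _ _)

  mulC-correct : ∀ m k → Eval O mulC (m ∷ k ∷ []) (m * k)
  mulC-correct zero k = e-prec0 e-zer
  mulC-correct (suc m) k = e-precS (mulC-correct m k) (ev-+ᶜ e-proj e-proj)

  ev-*ᶜ : Eval O a xs u → Eval O b xs v → Eval O (a *ᶜ b) xs (u * v)
  ev-*ᶜ ea eb = ev-comp₂ ea eb (mulC-correct _ _)

  ev-∣-ᶜ∣ : Eval O a xs u → Eval O b xs v → Eval O ∣ a -ᶜ b ∣ xs ∣ u - v ∣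
  ev-∣-ᶜ∣ {u = u} {v = v} ea eb =
    subst (Eval O _ _) (sym (∣m-n∣≡m∸n+n∸m u v)) (ev-+ᶜ (ev-∸ᶜ ea eb) (ev-∸ᶜ eb ea))

  mod2C-correct : ∀ m → Eval O mod2C (m ∷ []) (m % 2)
  mod2C-correct zero = e-prec0 e-zer
  mod2C-correct (suc m) = subst (Eval O mod2C _) (sym ([1+n]%2≡1∸n%2 m))
    (e-precS (mod2C-correct m) (ev-∸ᶜ ev-one e-proj))

  halfC-correct : ∀ m → Eval O halfC (m ∷ []) (m / 2)
  halfC-correct zero = e-prec0 e-zer
  halfC-correct (suc m) = subst (Eval O halfC _) (sym ([1+n]/2≡n/2+n%2 m))
    (e-precS (halfC-correct m) (ev-+ᶜ e-proj (ev-· e-proj (mod2C-correct m))))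

  pow2C-correct : ∀ k → Eval O pow2C (k ∷ []) (2 ^ k)
  pow2C-correct zero = e-prec0 ev-one
  pow2C-correct (suc k) = e-precS (pow2C-correct k) (ev-*ᶜ ev-two e-proj)

  halve^C-correct : ∀ i c → Eval O halve^C (i ∷ c ∷ []) (halve^ i c)
  halve^C-correct zero c = e-prec0 e-proj
  halve^C-correct (suc i) c = e-precS (halve^C-correct i c) (ev-· e-proj (halfC-correct _))

  ev-mu : ∀ {g : Code (suc n)} {F : ℕ → ℕ} {k} → (∀ i → Eval O g (i ∷ xs) (F i)) →
          F k ≡ 0 → (∀ j → j < k → F j ≢ 0) → Eval O (mu g) xs k
  ev-mu {F = F} ev Fk≡0 Fj≢0 = e-mu (subst (Eval O _ _) Fk≡0 (ev _)) λ j j<k →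
    pred (F j) , subst (Eval O _ _) (sym (suc-pred (F j) {{≢-nonZero (Fj≢0 j j<k)}})) (ev j)

  minElemC-correct : ∀ c → Eval O minElemC (c ∷ []) (minElem c)
  minElemC-correct c = ev-mu test (lowBitTest-minElem c) (lowBitTest-below-minElem c)
    where
    test : ∀ i → Eval O lowBitTestC (i ∷ c ∷ []) (lowBitTest i c)
    test i = ev-*ᶜ e-proj (ev-∸ᶜ ev-one (ev-· (halve^C-correct i c) (mod2C-correct _)))

  dropMinC-correct : ∀ c → Eval O dropMinC (c ∷ []) (dropMin c)
  dropMinC-correct c = ev-∸ᶜ e-proj (ev-· (minElemC-correct c) (pow2C-correct _))

Φ-computes : ∀ f → Computes f Φ (rainbowInstance f)
Φ-computes f c = ev-*ᶜ (ev-· (ev-∣-ᶜ∣ (ev-*ᶜ ev-two (minElemC-correct c)) (ev-· (dropMinC-correct c) e-orc))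
                             (pow2C-correct _))
                       (ev-· (ev-*ᶜ ev-two (dropMinC-correct c)) e-succ)

countC-correct : ∀ Y n → Eval (χ Y) countC (n ∷ []) (count Y n)
countC-correct Y zero = e-prec0 e-zer
countC-correct Y (suc n) = e-precS (countC-correct Y n) (ev-+ᶜ e-proj (ev-· e-proj e-orc))

Ψ-computes : ∀ Y → Computes (χ Y) Ψ (χ (dropTwoMin Y))
Ψ-computes Y n = subst (Eval (χ Y) Ψ _) (sym (χ-dropTwoMin {Y} n))
  (ev-*ᶜ (ev-· e-proj e-orc) (ev-∸ᶜ ev-one (ev-∸ᶜ ev-two (ev-· e-proj (countC-correct Y n)))))

proposition4p11 : TS!ω ≤sW RRT!ω+1₂
proposition4p11 = Φ , Ψ , λ f _ →
  rainbowInstance f , Φ-computes f , rainbowInstance-2-bounded f ,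
  λ Y (Y-infinite , Y-rainbow) →
    dropTwoMin Y , Ψ-computes Y , dropTwoMin-infinite Y-infinite , dropTwoMin-avoids f Y-infinite Y-rainbow
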